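{- Consider the following data structure, for a directed graph $G=(V,E)$ with $m$ initial edges undergoing edge deletions, a fixed node $x$ and a fixed integer $h\ge1$. It stores a set $R(x)\subseteq V$, initialized to $V$ and modified only by the following procedure ApproximatePathUnion$(y)$, which may be called with any node $y$ at any time (with $G$ the current graph): (1) Compute $B_1=\{v\in R(x): \mathrm{dist}_{G[R(x)]}(v,y)\le h\}$. (2) For $i=2,\dots,\lceil\log m\rceil+1$: compute $B_i=\{v\in R(x): \mathrm{dist}_{G[R(x)]}(v,y)\le ih\}$; if $|E(B_i)|\le 2|E(B_{i-1})|$, then compute $F=\{v\in B_i: \mathrm{dist}_{G[B_i]}(x,v)\le h\}$, set $X=B_{i-1}\setminus F$, replace $R(x)$ by $R(x)\setminus X$, and return $F$. Suppose that at the start of a call of ApproximatePathUnion$(y)$ we have $\{v\in V: \mathrm{dist}_G(x,v)\le h\}\subseteq R(x)$. Then every node $v\in X$ removed from $R(x)$ during this call satisfies $\mathrm{dist}_G(x,v)>h$.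
   Context: $\mathrm{dist}_H(u,v)$ is the directed unweighted shortest-path distance from $u$ to $v$ in graph $H$ ($\infty$ if unreachable). For $U\subseteq V$, $E(U)=E\cap U^2$ and $G[U]=(U,E(U))$ is the induced subgraph. Logarithms are base 2. -}

module Defs where

open import Data.Nat using (ℕ; zero; suc; _≤_)
open import Data.Bool using (Bool; true; false; _∧_; if_then_else_)
open import Data.Fin using (Fin)
open import Data.Fin.Subset using (Subset; _∈_)
open import Data.Vec using (tabulate; lookup; sum)
open import Data.Product using (∃; _×_)
open import Relation.Binary.PropositionalEquality using (_≡_)

-- A directed graph on vertex set Fin n (no multi-edges), given by its
-- (decidable) edge relation.
Graph : ℕ → Set
Graph n = Fin n → Fin n → Bool

_⊆ᴱ_ : ∀ {n} → Graph n → Graph n → Set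
G ⊆ᴱ G₀ = ∀ a b → G a b ≡ true → G₀ a b ≡ true

edgeCount : ∀ {n} → Graph n → Subset n → ℕ
edgeCount {n} G U =
  sum (tabulate λ a → sum (tabulate λ b →
    if lookup U a ∧ lookup U b ∧ G a b then 1 else 0))

data Walk {n : ℕ} (G : Graph n) (U : Subset n) : ℕ → Fin n → Fin n → Set where
  here : ∀ {u} → u ∈ U → Walk G U 0 u u
  step : ∀ {k u w v} → u ∈ U → G u w ≡ true → Walk G U k w v →
         Walk G U (suc k) u v

DistLe : ∀ {n} → Graph n → Subset n → Fin n → Fin n → ℕ → Set
DistLe G U u v k = ∃ λ ℓ → ℓ ≤ k × Walk G U ℓ u v

module Submission where

-- Let W be a walk of length ℓ ≤ h from x to v in G. Every vertex on W is
-- within distance h of x in G, hence in R, so W is a walk in G[R]. Every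
-- vertex on W then reaches v within h in G[R], and v reaches y within
-- (i-1)h there, so W lies in B_i = {u ∈ R : dist_{G[R]}(u,y) ≤ ih}. Thus
-- dist_{G[B_i]}(x,v) ≤ h and v ∈ F.

open import Defs
open import Data.Nat using (ℕ; suc; _≤_; _<_; _*_; _+_; _>_; _∸_; z≤n)
open import Data.Nat.Properties using (≤-trans; ≤-reflexive; m+n≤o⇒m≤o; m+n≤o⇒n≤o; +-mono-≤)
open import Data.Nat.Logarithm using (⌈log₂_⌉)
open import Data.Fin using (Fin)
open import Data.Fin.Subset using (Subset; _∈_; _∉_; ⊤)
open import Data.Product using (_×_; _,_; proj₁; proj₂)
open import Function.Bundles using (_⇔_; Equivalence)
open import Relation.Nullary using (¬_)
open import Relation.Binary.PropositionalEquality using (_≡_; refl; cong)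

module _ {n : ℕ} {G : Graph n} where

  Walk-source : ∀ {U k u v} → Walk G U k u v → u ∈ U
  Walk-source (here u∈U)     = u∈U
  Walk-source (step u∈U _ _) = u∈U

  _++ᵂ_ : ∀ {U a b u w v} → Walk G U a u w → Walk G U b w v → Walk G U (a + b) u v
  here _     ++ᵂ Q = Q
  step p e P ++ᵂ Q = step p e (P ++ᵂ Q)

  DistLe-trans : ∀ {U u w v a b} → DistLe G U u w a → DistLe G U w v b → DistLe G U u v (a + b)
  DistLe-trans (k , k≤a , P) (l , l≤b , Q) = k + l , +-mono-≤ k≤a l≤b , P ++ᵂ Q

  -- A vertex u lies on a walk s ⇝ t of length k iff the walk splits at u.
  Walk-restrict : ∀ {U V k s t} →
    (∀ {a b u} → a + b ≡ k → Walk G U a s u → Walk G U b u t → u ∈ V) →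
    Walk G U k s t → Walk G V k s t
  Walk-restrict on-walk⊆V (here s∈U) = here (on-walk⊆V refl (here s∈U) (here s∈U))
  Walk-restrict on-walk⊆V (step s∈U e W) =
    step (on-walk⊆V refl (here s∈U) (step s∈U e W)) e
         (Walk-restrict (λ eq P Q → on-walk⊆V (cong suc eq) (step s∈U e P) Q) W)

  Walk-restrict-outBall : ∀ {U V ℓ h s t} → (∀ u → DistLe G U s u h → u ∈ V) →
    ℓ ≤ h → Walk G U ℓ s t → Walk G V ℓ s t
  Walk-restrict-outBall outBall⊆V ℓ≤h = Walk-restrict λ {a} {_} {u} eq P _ →
    outBall⊆V u (a , m+n≤o⇒m≤o a (≤-trans (≤-reflexive eq) ℓ≤h) , P)

  Walk-restrict-inBall : ∀ {U V ℓ h s t} → (∀ u → DistLe G U u t h → u ∈ V) →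
    ℓ ≤ h → Walk G U ℓ s t → Walk G V ℓ s t
  Walk-restrict-inBall inBall⊆V ℓ≤h = Walk-restrict λ {a} {b} {u} eq _ Q →
    inBall⊆V u (b , m+n≤o⇒n≤o a (≤-trans (≤-reflexive eq) ℓ≤h) , Q)

lemma3p2 : ∀ {n : ℕ} (G₀ G : Graph n) (m : ℕ) → m ≡ edgeCount G₀ ⊤ → G ⊆ᴱ G₀ →
    (x y : Fin n) (h : ℕ) → 1 ≤ h →
    (R : Subset n) →
    (∀ v → DistLe G ⊤ x v h → v ∈ R) →
    (B : ℕ → Subset n) →
    (∀ i v → (v ∈ B i) ⇔ (v ∈ R × DistLe G R v y (i * h))) →
    (i : ℕ) → 2 ≤ i → i ≤ ⌈log₂ m ⌉ + 1 →
    (∀ j → 2 ≤ j → j < i → edgeCount G (B j) > 2 * edgeCount G (B (j ∸ 1))) →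
    edgeCount G (B i) ≤ 2 * edgeCount G (B (i ∸ 1)) →
    (F : Subset n) →
    (∀ v → (v ∈ F) ⇔ (v ∈ B i × DistLe G (B i) x v h)) →
    ∀ v → v ∈ B (i ∸ 1) → v ∉ F → ¬ DistLe G ⊤ x v h
lemma3p2 _ G _ _ _ x y h _ R ball⊆R B B-def (suc j) _ _ _ _ F F-def v v∈Bj v∉F (ℓ , ℓ≤h , W) =
  v∉F (Equivalence.from (F-def v) (v∈Bi , ℓ , ℓ≤h , W-in-Bi))
  where
  v-near-y : DistLe G R v y (j * h)
  v-near-y = proj₂ (Equivalence.to (B-def j v) v∈Bj)

  inBall⊆Bi : ∀ u → DistLe G R u v h → u ∈ B (suc j)
  inBall⊆Bi u u-near-v = Equivalence.from (B-def (suc j) u)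
    (Walk-source (proj₂ (proj₂ u-near-v)) , DistLe-trans u-near-v v-near-y)

  v∈Bi : v ∈ B (suc j)
  v∈Bi = inBall⊆Bi v (0 , z≤n , here (proj₁ (Equivalence.to (B-def j v) v∈Bj)))

  W-in-Bi : Walk G (B (suc j)) ℓ x v
  W-in-Bi = Walk-restrict-inBall inBall⊆Bi ℓ≤h (Walk-restrict-outBall ball⊆R ℓ≤h W)
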